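{- Let $G$ be a connected graph of order $n\geq 4$ with maximum degree $\Delta(G)$, and let $C(G)$ be its central graph. Then $D'(C(G))\leq \lceil \sqrt{\Delta(G)}\rceil$.
   Context: All graphs are simple, finite, undirected. The central graph $C(G)$ of $G$ has vertex set $V(G)\cup\{w_{u,v}:\{u,v\}\in E(G)\}$ (one new vertex $w_{u,v}$ for each edge of $G$), and edge set consisting of all pairs $\{u,v\}$ with $u\neq v\in V(G)$ and $\{u,v\}\notin E(G)$, together with the edges $\{u,w_{u,v}\}$ and $\{w_{u,v},v\}$ for every $\{u,v\}\in E(G)$ (i.e. each edge of $G$ is subdivided once and all non-adjacent pairs of original vertices are joined). An automorphism $\phi$ of a graph $H$ preserves an edge coloring $f$ (not necessarily proper) if $f(\phi(e))=f(e)$ for all edges $e$. The distinguishing index $D'(H)$ is the least integer $d$ such that $H$ has an edge coloring with $d$ colors preserved only by the identity automorphism. -}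

module Defs where

open import Data.Nat using (ℕ; zero; suc; _*_; _≤_; _≤ᵇ_; _<ᵇ_; _⊔_)
open import Data.Fin using (Fin; toℕ)
open import Data.Bool using (Bool; true; false; _∧_; T; if_then_else_)
open import Data.List using (List; length; filter; map; foldr; allFin)
open import Data.Product using (Σ; _×_; _,_; ∃-syntax)
open import Data.Sum using (_⊎_; inj₁; inj₂)
open import Data.Empty using (⊥)
open import Relation.Binary.PropositionalEquality using (_≡_; _≢_)
open import Relation.Nullary using (¬_)
open import Relation.Nullary.Decidable using (does)
open import Function.Bundles using (_↔_; Inverse; _⇔_)

record SimpleGraph (n : ℕ) : Set where
  field
    adj     : Fin n → Fin n → Bool
    symm    : ∀ u v → adj u v ≡ adj v u
    irrefl  : ∀ v → adj v v ≡ false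

open SimpleGraph public

data Walk {n : ℕ} (G : SimpleGraph n) : Fin n → Fin n → Set where
  here : ∀ {u} → Walk G u u
  step : ∀ {u w v} → adj G u w ≡ true → Walk G w v → Walk G u v

Connected : ∀ {n} → SimpleGraph n → Set
Connected G = ∀ u v → Walk G u v

degree : ∀ {n} → SimpleGraph n → Fin n → ℕ
degree {n} G v = length (filter (λ u → Data.Bool._≟_ (adj G u v) true) (allFin n))

maxDegree : ∀ {n} → SimpleGraph n → ℕ
maxDegree {n} G = foldr _⊔_ 0 (map (degree G) (allFin n))

private
  search : ℕ → ℕ → ℕ → ℕ
  search m k zero    = k
  search m k (suc f) = if m ≤ᵇ k * k then k else search m (suc k) f

ceilSqrt : ℕ → ℕ
ceilSqrt m = search m 0 (suc m)

record Graph : Set₁ where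
  field
    V   : Set
    Adj : V → V → Set

open Graph public

record Automorphism (H : Graph) : Set where
  field
    perm     : V H ↔ V H
    preserve : ∀ x y → Adj H x y ⇔ Adj H (Inverse.to perm x) (Inverse.to perm y)

open Automorphism public

-- edge colourings with d colours: colours of unordered pairs
-- (only values on edges are relevant)
record EdgeColoring (H : Graph) (d : ℕ) : Set where
  field
    col  : V H → V H → Fin d
    csym : ∀ x y → col x y ≡ col y x

open EdgeColoring public

Preserves : ∀ {H d} → Automorphism H → EdgeColoring H d → Set
Preserves {H} φ c =
  ∀ x y → Adj H x y → col c (Inverse.to (perm φ) x) (Inverse.to (perm φ) y) ≡ col c x y

Distinguishing : ∀ {H d} → EdgeColoring H d → Set
Distinguishing {H} c =
  ∀ (φ : Automorphism H) → Preserves φ c → ∀ x → Inverse.to (perm φ) x ≡ x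

DistIndexLE : Graph → ℕ → Set
DistIndexLE H k = ∃[ d ] (d ≤ k × Σ (EdgeColoring H d) Distinguishing)

isEdgeOrd : ∀ {n} → SimpleGraph n → Fin n × Fin n → Bool
isEdgeOrd G (u , v) = adj G u v ∧ (toℕ u <ᵇ toℕ v)

EdgeOf : ∀ {n} → SimpleGraph n → Set
EdgeOf {n} G = Σ (Fin n × Fin n) (λ p → T (isEdgeOrd G p))

CVertex : ∀ {n} → SimpleGraph n → Set
CVertex {n} G = Fin n ⊎ EdgeOf G

CAdj : ∀ {n} (G : SimpleGraph n) → CVertex G → CVertex G → Set
CAdj G (inj₁ u) (inj₁ v) = u ≢ v × adj G u v ≡ false
CAdj G (inj₁ u) (inj₂ ((a , b) , _)) = u ≡ a ⊎ u ≡ b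
CAdj G (inj₂ ((a , b) , _)) (inj₁ u) = u ≡ a ⊎ u ≡ b
CAdj G (inj₂ _) (inj₂ _) = ⊥

central : ∀ {n} → SimpleGraph n → Graph
central G = record { V = CVertex G ; Adj = CAdj G }

{-# OPTIONS --safe #-}
module Submission where

-- Two colours already suffice, and ⌈√Δ⌉ ≥ 2 since a connected graph on at least three
-- vertices has a vertex of degree 2.  Number the vertices 0, …, n − 1.  An edge {i, j} of
-- C(G) between original vertices gets colour 1 iff |i − j| = 1, and the two halves of the
-- subdivided edge {i, j} get equal colours iff |i − j| = 1.  An automorphism of C(G) maps
-- original vertices to original vertices (they have n − 1 ≥ 3 neighbours, subdivision
-- vertices two), so it induces a permutation σ of {0, …, n − 1} preserving |i − j| = 1;
-- such a σ is the identity or the reversal i ↦ n − 1 − i.  The reversal is excluded by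
-- the colours on the subdivided edge from 0 to one of its neighbours, and a subdivision
-- vertex is fixed once its two neighbours are.

open import Defs
open import Data.Nat
  using (ℕ; _≤_; _<_; NonZero; zero; suc; _+_; _*_; _≤ᵇ_; _<ᵇ_; _≟_; z≤n; s≤s; z<s; s<s)
open import Data.Nat.Properties
  using (≤-refl; ≤-trans; <-≤-trans; <⇒≤; <⇒≱; <-irrefl; <-asym; <-cmp; <⇒<ᵇ; <ᵇ⇒<; n≤1+n; 1+n≢n;
         n≤0⇒n≡0; m≤m+n; m≤n+m; +-comm; +-identityʳ; +-suc; +-cancelʳ-≤; suc-injective;
         m⊔n≤o⇒m≤o; m⊔n≤o⇒n≤o)
open import Data.Nat.DivMod using (_mod_; m<n⇒m%n≡m)
open import Data.Bool using (true; false; if_then_else_)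
open import Data.Bool.Properties using (T-∧; T-≡; T-irrelevant; ¬-not) renaming (_≟_ to _≟ᵇ_)
open import Data.Fin using (Fin; toℕ; suc; punchIn) renaming (_≟_ to _≟ᶠ_; _<_ to _<ᶠ_)
open import Data.Fin.Patterns using (0F; 1F; 2F)
open import Data.Fin.Properties
  using (toℕ-injective; toℕ-fromℕ<; toℕ≤pred[n]; punchIn-injective; punchInᵢ≢i; pigeonhole)
  renaming (<⇒≢ to <⇒≢ᶠ)
open import Data.List using (List; []; _∷_; length; map; allFin)
open import Data.List.Properties using (foldr-forcesᵇ)
open import Data.List.Relation.Unary.All as All using (All)
open import Data.List.Relation.Unary.Any using (here)
open import Data.List.Membership.Propositional using (_∈_)
open import Data.List.Membership.Propositional.Properties using (∈-allFin; ∈-filter⁺; ∈-map⁺)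
open import Data.Product using (_×_; _,_; proj₁; proj₂; ∃-syntax; ∃₂)
open import Data.Sum using (_⊎_; inj₁; inj₂; swap; [_,_])
open import Data.Sum.Properties using (inj₁-injective)
open import Data.Empty using (⊥-elim)
open import Function using (_∘_)
open import Function.Bundles using (Inverse; Injection; Equivalence)
open import Function.Definitions using (Injective)
open import Function.Properties.Inverse using (↔⇒↣; ↔-sym)
open import Relation.Nullary using (¬_; Dec; yes; no; contradiction)
open import Relation.Nullary.Decidable using (_⊎-dec_)
open import Relation.Unary using (Pred; Decidable)
open import Relation.Binary using (tri<; tri≈; tri>)
open import Relation.Binary.PropositionalEquality
  using (_≡_; _≢_; refl; sym; trans; cong; cong₂; subst; subst₂; module ≡-Reasoning)

-- `search` is private to Defs; abstracting the arguments of its call inside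
-- `ceilSqrt (2 + m)` lets unification solve the meta below with it.
mutual
  search : ℕ → ℕ → ℕ → ℕ
  search = _

  ceilSqrt-unfold : ∀ m → ceilSqrt (2 + m) ≡ (if m <ᵇ 3 then 2 else search (2 + m) 3 m)
  ceilSqrt-unfold m with 2 + m | 3
  ... | _ | _ = refl

search-≥ : ∀ m k f → k ≤ search m k f
search-≥ m k zero = ≤-refl
search-≥ m k (suc f) with m ≤ᵇ k * k
... | true  = ≤-refl
... | false = <⇒≤ (search-≥ m (suc k) f)

2≤ceilSqrt : ∀ {m} → 2 ≤ m → 2 ≤ ceilSqrt m
2≤ceilSqrt (s≤s (s≤s {n = m} _)) = search-≥ (2 + m) 2 (1 + m)

distinct-members⇒2≤length : ∀ {A : Set} {x y : A} {xs : List A} → x ∈ xs → y ∈ xs → x ≢ y → 2 ≤ length xs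
distinct-members⇒2≤length {xs = _ ∷ _ ∷ _} _ _ _ = s≤s (s≤s z≤n)
distinct-members⇒2≤length {xs = _ ∷ []} (here refl) (here refl) x≢y = contradiction refl x≢y

module _ {n : ℕ} (G : SimpleGraph n) where

  degree≤maxDegree : ∀ v → degree G v ≤ maxDegree G
  degree≤maxDegree v = All.lookup degrees≤max (∈-map⁺ (degree G) (∈-allFin v))
    where
    degrees≤max : All (_≤ maxDegree G) (map (degree G) (allFin n))
    degrees≤max = foldr-forcesᵇ (λ x y x⊔y≤ → m⊔n≤o⇒m≤o x y x⊔y≤ , m⊔n≤o⇒n≤o x y x⊔y≤) 0 _ ≤-refl

  distinct-neighbours⇒2≤degree : ∀ {v p q} → adj G p v ≡ true → adj G q v ≡ true → p ≢ q → 2 ≤ degree G v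
  distinct-neighbours⇒2≤degree {v} p~v q~v =
    distinct-members⇒2≤length (∈-filter⁺ neighbour? (∈-allFin _) p~v) (∈-filter⁺ neighbour? (∈-allFin _) q~v)
    where
    neighbour? = λ u → adj G u v ≟ᵇ true

  walk-enters : ∀ {ℓ} (P : Pred (Fin n) ℓ) → Decidable P → ∀ {x y} → Walk G x y → ¬ P x → P y →
                ∃₂ λ x′ y′ → adj G x′ y′ ≡ true × ¬ P x′ × P y′
  walk-enters P P? here ¬Px Py = contradiction Py ¬Px
  walk-enters P P? (step {w = w} x~w w⇝y) ¬Px Py with P? w
  ... | yes Pw = _ , w , x~w , ¬Px , Pw
  ... | no ¬Pw = walk-enters P P? w⇝y ¬Pw Py

  connected⇒neighbour : Connected G → ∀ {u v} → u ≢ v → ∃[ w ] adj G w v ≡ true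
  connected⇒neighbour connected {u} {v} u≢v with walk-enters (_≡ v) (_≟ᶠ v) (connected u v) u≢v refl
  ... | w , _ , w~v , _ , refl = w , w~v

avoiding-0F-and : ∀ {n} (a : Fin (3 + n)) → ∃[ c ] c ≢ 0F × c ≢ a
avoiding-0F-and 0F = 1F , (λ ()) , (λ ())
avoiding-0F-and 1F = 2F , (λ ()) , (λ ())
avoiding-0F-and (suc (suc a)) = 1F , (λ ()) , (λ ())

-- A walk from a third vertex c into the edge {0, a} enters it through an end of degree ≥ 2.
connected⇒2≤maxDegree : ∀ {n} (G : SimpleGraph (3 + n)) → Connected G → 2 ≤ maxDegree G
connected⇒2≤maxDegree G connected
  with connected⇒neighbour G connected {1F} {0F} (λ ())
... | a , a~0 with avoiding-0F-and a
...   | c , c≢0 , c≢a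
        with walk-enters G (λ z → z ≡ 0F ⊎ z ≡ a) (λ z → (z ≟ᶠ 0F) ⊎-dec (z ≟ᶠ a)) (connected c 0F)
               [ c≢0 , c≢a ] (inj₁ refl)
...     | x , _ , x~0 , x∉ , inj₁ refl =
  ≤-trans (distinct-neighbours⇒2≤degree G x~0 a~0 (x∉ ∘ inj₂)) (degree≤maxDegree G 0F)
...     | x , _ , x~a , x∉ , inj₂ refl =
  ≤-trans (distinct-neighbours⇒2≤degree G x~a (trans (symm G 0F a) a~0) (x∉ ∘ inj₁)) (degree≤maxDegree G a)

Consecutive : ℕ → ℕ → Set
Consecutive i j = suc i ≡ j ⊎ suc j ≡ i

consecutive? : ∀ i j → Dec (Consecutive i j)
consecutive? i j = (suc i ≟ j) ⊎-dec (suc j ≟ i)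

directColour : ℕ → ℕ → Fin 2
directColour i j with consecutive? i j
... | yes _ = 1F
... | no _  = 0F

directColour-sym : ∀ i j → directColour i j ≡ directColour j i
directColour-sym i j with consecutive? i j | consecutive? j i
... | yes _ | yes _  = refl
... | no _  | no _   = refl
... | yes c | no ¬c  = contradiction (swap c) ¬c
... | no ¬c | yes c  = contradiction (swap c) ¬c

consecutive⇒directColour≡1F : ∀ {i j} → Consecutive i j → directColour i j ≡ 1F
consecutive⇒directColour≡1F {i} {j} c with consecutive? i j
... | yes _ = refl
... | no ¬c = contradiction c ¬c

directColour≡1F⇒consecutive : ∀ {i j} → directColour i j ≡ 1F → Consecutive i j
directColour≡1F⇒consecutive {i} {j} eq with consecutive? i j
... | yes c = c

consecutiveTip : ℕ → Fin 2
consecutiveTip 1 = 0F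
consecutiveTip _ = 1F

consecutiveTip≡0F⇒≡1 : ∀ k → consecutiveTip k ≡ 0F → k ≡ 1
consecutiveTip≡0F⇒≡1 1 _ = refl

orderTip : ℕ → ℕ → Fin 2
orderTip zero    zero    = 1F
orderTip zero    (suc _) = 0F
orderTip (suc _) zero    = 1F
orderTip (suc i) (suc j) = orderTip i j

orderTip-sym⇒≡ : ∀ i j → orderTip i j ≡ orderTip j i → i ≡ j
orderTip-sym⇒≡ zero    zero    _  = refl
orderTip-sym⇒≡ (suc i) (suc j) eq = cong suc (orderTip-sym⇒≡ i j eq)

orderTip≡0F⇒< : ∀ i j → orderTip i j ≡ 0F → i < j
orderTip≡0F⇒< zero    (suc _) _  = z<s
orderTip≡0F⇒< (suc i) (suc j) eq = s<s (orderTip≡0F⇒< i j eq)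

-- The colour of the half at i of the subdivided edge {i, j}.  Besides detecting
-- consecutive pairs, it singles out {0, 1} (the consecutive pair with i + j = 1)
-- and orients all non-consecutive pairs, which is what rules out the reversal.
tip : ℕ → ℕ → Fin 2
tip i j with consecutive? i j
... | yes _ = consecutiveTip (i + j)
... | no _  = orderTip i j

consecutive⇒tip-sym : ∀ {i j} → Consecutive i j → tip i j ≡ tip j i
consecutive⇒tip-sym {i} {j} c with consecutive? i j | consecutive? j i
... | yes _ | yes _ = cong consecutiveTip (+-comm i j)
... | no ¬c | _     = contradiction c ¬c
... | _     | no ¬c = contradiction (swap c) ¬c

tip-sym⇒consecutive : ∀ {i j} → i ≢ j → tip i j ≡ tip j i → Consecutive i j
tip-sym⇒consecutive {i} {j} i≢j eq with consecutive? i j | consecutive? j i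
... | yes c | _     = c
... | no ¬c | yes c = contradiction (swap c) ¬c
... | no _  | no _  = contradiction (orderTip-sym⇒≡ i j eq) i≢j

tip≡0F⇒<∨≤1 : ∀ {i j} → tip i j ≡ 0F → i < j ⊎ i ≤ 1
tip≡0F⇒<∨≤1 {i} {j} eq with consecutive? i j
... | yes _ = inj₂ (subst (i ≤_) (consecutiveTip≡0F⇒≡1 (i + j) eq) (m≤m+n i j))
... | no _  = inj₁ (orderTip≡0F⇒< i j eq)

tip-zero-suc : ∀ k → tip 0 (suc k) ≡ 0F
tip-zero-suc k with consecutive? 0 (suc k)
... | yes (inj₁ refl) = refl
... | no _            = refl

ascending⇒arithmetic : ∀ (s : ℕ → ℕ) M → (∀ i → i < M → suc (s i) ≡ s (suc i)) →
                       ∀ i → i ≤ M → s i ≡ s 0 + i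
ascending⇒arithmetic s M rise zero    _   = sym (+-identityʳ (s 0))
ascending⇒arithmetic s M rise (suc i) i<M = begin
  s (suc i)       ≡⟨ rise i i<M ⟨
  suc (s i)       ≡⟨ cong suc (ascending⇒arithmetic s M rise i (<⇒≤ i<M)) ⟩
  suc (s 0 + i)   ≡⟨ +-suc (s 0) i ⟨
  s 0 + suc i     ∎
  where open ≡-Reasoning

descending⇒arithmetic : ∀ (s : ℕ → ℕ) M → (∀ i → i < M → suc (s (suc i)) ≡ s i) →
                        ∀ i → i ≤ M → s i + i ≡ s 0
descending⇒arithmetic s M fall zero    _   = +-identityʳ (s 0)
descending⇒arithmetic s M fall (suc i) i<M = begin
  s (suc i) + suc i   ≡⟨ +-suc (s (suc i)) i ⟩
  suc (s (suc i)) + i ≡⟨ cong (_+ i) (fall i i<M) ⟩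
  s i + i             ≡⟨ descending⇒arithmetic s M fall i (<⇒≤ i<M) ⟩
  s 0                 ∎
  where open ≡-Reasoning

consecutive-walk-monotone : ∀ (s : ℕ → ℕ) M → 0 < M →
  (∀ i → i < M → Consecutive (s i) (s (suc i))) →
  (∀ i → suc i < M → s (suc (suc i)) ≢ s i) →
  (∀ i → i ≤ M → s i ≡ s 0 + i) ⊎ (∀ i → i ≤ M → s i + i ≡ s 0)
consecutive-walk-monotone s M 0<M moves no-return with moves 0 0<M
... | inj₁ up   = inj₁ (ascending⇒arithmetic s M (rises up))
  where
  rises : suc (s 0) ≡ s 1 → ∀ i → i < M → suc (s i) ≡ s (suc i)
  rises up zero    _     = up
  rises up (suc i) 1+i<M with moves (suc i) 1+i<M
  ... | inj₁ rise = rise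
  ... | inj₂ fall = contradiction (suc-injective (trans fall (sym (rises up i (<⇒≤ 1+i<M))))) (no-return i 1+i<M)
... | inj₂ down = inj₂ (descending⇒arithmetic s M (falls down))
  where
  falls : suc (s 1) ≡ s 0 → ∀ i → i < M → suc (s (suc i)) ≡ s i
  falls down zero    _     = down
  falls down (suc i) 1+i<M with moves (suc i) 1+i<M
  ... | inj₂ fall = fall
  ... | inj₁ rise = contradiction (trans (sym rise) (falls down i (<⇒≤ 1+i<M))) (no-return i 1+i<M)

module CentralGraph {n : ℕ} (G : SimpleGraph n) where

  Endpoint : Fin n → EdgeOf G → Set
  Endpoint x E = CAdj G (inj₁ x) (inj₂ E)

  endpoints-< : ∀ (E : EdgeOf G) → toℕ (proj₁ (proj₁ E)) < toℕ (proj₂ (proj₁ E))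
  endpoints-< ((a , b) , a~b∧a<b) = <ᵇ⇒< (toℕ a) (toℕ b) (proj₂ (Equivalence.to T-∧ a~b∧a<b))

  adj⇒≢ : ∀ {u v} → adj G u v ≡ true → u ≢ v
  adj⇒≢ {u} u~v refl with () ← trans (sym u~v) (irrefl G u)

  edgeBetween : ∀ u v → adj G u v ≡ true → EdgeOf G
  edgeBetween u v u~v with <-cmp (toℕ u) (toℕ v)
  ... | tri< u<v _ _ = (u , v) , Equivalence.from T-∧ (Equivalence.from T-≡ u~v , <⇒<ᵇ u<v)
  ... | tri≈ _ u≡v _ = contradiction (toℕ-injective u≡v) (adj⇒≢ u~v)
  ... | tri> _ _ v<u = (v , u) , Equivalence.from T-∧ (Equivalence.from T-≡ (trans (symm G v u) u~v) , <⇒<ᵇ v<u)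

  edgeBetween-endpointˡ : ∀ {u v} (u~v : adj G u v ≡ true) → Endpoint u (edgeBetween u v u~v)
  edgeBetween-endpointˡ {u} {v} u~v with <-cmp (toℕ u) (toℕ v)
  ... | tri< _ _ _   = inj₁ refl
  ... | tri≈ _ u≡v _ = contradiction (toℕ-injective u≡v) (adj⇒≢ u~v)
  ... | tri> _ _ _   = inj₂ refl

  edgeBetween-endpointʳ : ∀ {u v} (u~v : adj G u v ≡ true) → Endpoint v (edgeBetween u v u~v)
  edgeBetween-endpointʳ {u} {v} u~v with <-cmp (toℕ u) (toℕ v)
  ... | tri< _ _ _   = inj₂ refl
  ... | tri≈ _ u≡v _ = contradiction (toℕ-injective u≡v) (adj⇒≢ u~v)
  ... | tri> _ _ _   = inj₁ refl

  edge-extensional : ∀ E E′ → (∀ x → Endpoint x E → Endpoint x E′) → E ≡ E′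
  edge-extensional E@((a , b) , _) E′@((a′ , b′) , _) E⊆E′ with E⊆E′ a (inj₁ refl) | E⊆E′ b (inj₂ refl)
  ... | inj₁ refl | inj₂ refl = cong ((a , b) ,_) (T-irrelevant _ _)
  ... | inj₁ refl | inj₁ refl = ⊥-elim (<-irrefl refl (endpoints-< E))
  ... | inj₂ refl | inj₂ refl = ⊥-elim (<-irrefl refl (endpoints-< E))
  ... | inj₂ refl | inj₁ refl = ⊥-elim (<-asym (endpoints-< E) (endpoints-< E′))

  other : Fin n → EdgeOf G → Fin n
  other x ((a , b) , _) with x ≟ᶠ a
  ... | yes _ = b
  ... | no _  = a

  other-endpoint : ∀ E {x y} → x ≢ y → Endpoint x E → Endpoint y E → other x E ≡ y
  other-endpoint ((a , b) , _) {x} {y} x≢y x∈E y∈E with x ≟ᶠ a | x∈E | y∈E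
  ... | yes refl | _         | inj₁ refl = contradiction refl x≢y
  ... | yes refl | _         | inj₂ refl = refl
  ... | no _     | _         | inj₁ refl = refl
  ... | no x≢a   | inj₁ x≡a  | inj₂ _    = contradiction x≡a x≢a
  ... | no _     | inj₂ refl | inj₂ refl = contradiction refl x≢y

  endpoint : EdgeOf G → Fin 2 → Fin n
  endpoint ((a , _) , _) 0F = a
  endpoint ((_ , b) , _) 1F = b

  subdivision-neighbour : ∀ E y → CAdj G (inj₂ E) y → ∃[ k ] y ≡ inj₁ (endpoint E k)
  subdivision-neighbour _ (inj₁ _) (inj₁ refl) = 0F , refl
  subdivision-neighbour _ (inj₁ _) (inj₂ refl) = 1F , refl

  neighbourToward : Fin n → Fin n → CVertex G
  neighbourToward u v with adj G u v ≟ᵇ true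
  ... | yes u~v = inj₂ (edgeBetween u v u~v)
  ... | no _    = inj₁ v

  neighbourToward-adjacent : ∀ {u v} → u ≢ v → CAdj G (inj₁ u) (neighbourToward u v)
  neighbourToward-adjacent {u} {v} u≢v with adj G u v ≟ᵇ true
  ... | yes u~v = edgeBetween-endpointˡ u~v
  ... | no u≁v  = u≢v , ¬-not u≁v

  neighbourToward-injective : ∀ {u v w} → neighbourToward u v ≡ neighbourToward u w → v ≡ w
  neighbourToward-injective {u} {v} {w} eq = trans (sym (far-neighbourToward v)) (trans (cong far eq) (far-neighbourToward w))
    where
    far : CVertex G → Fin n
    far (inj₁ v) = v
    far (inj₂ E) = other u E
    far-neighbourToward : ∀ v → far (neighbourToward u v) ≡ v
    far-neighbourToward v with adj G u v ≟ᵇ true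
    ... | yes u~v =
      other-endpoint (edgeBetween u v u~v) (adj⇒≢ u~v) (edgeBetween-endpointˡ u~v) (edgeBetween-endpointʳ u~v)
    ... | no _    = refl

-- An original vertex has at least three neighbours in C(G), a subdivision vertex only two.
original↛subdivision : ∀ {M} (G : SimpleGraph (suc M)) → 2 < M →
  (f : CVertex G → CVertex G) → Injective _≡_ _≡_ f → (∀ {x y} → CAdj G x y → CAdj G (f x) (f y)) →
  ∀ u E → f (inj₁ u) ≢ inj₂ E
original↛subdivision G 2<M f f-injective f-adjacent u E fu≡E = no-collision (pigeonhole 2<M side)
  where
  open CentralGraph G
  open ≡-Reasoning
  neighbour : Fin _ → CVertex G
  neighbour j = neighbourToward u (punchIn u j)
  landing : ∀ j → ∃[ k ] f (neighbour j) ≡ inj₁ (endpoint E k)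
  landing j = subdivision-neighbour E _
    (subst (λ z → CAdj G z (f (neighbour j))) fu≡E (f-adjacent (neighbourToward-adjacent (punchInᵢ≢i u j ∘ sym))))
  side : Fin _ → Fin 2
  side j = proj₁ (landing j)
  no-collision : ¬ ∃₂ λ i j → i <ᶠ j × side i ≡ side j
  no-collision (i , j , i<j , same-side) = <⇒≢ᶠ i<j (punchIn-injective u i j (neighbourToward-injective (f-injective (begin
    f (neighbour i)              ≡⟨ proj₂ (landing i) ⟩
    inj₁ (endpoint E (side i))   ≡⟨ cong (inj₁ ∘ endpoint E) same-side ⟩
    inj₁ (endpoint E (side j))   ≡⟨ proj₂ (landing j) ⟨
    f (neighbour j)              ∎))))

module _ {n : ℕ} (G : SimpleGraph n) where
  open CentralGraph G

  centralColour : CVertex G → CVertex G → Fin 2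
  centralColour (inj₁ u) (inj₁ v) = directColour (toℕ u) (toℕ v)
  centralColour (inj₁ x) (inj₂ E) = tip (toℕ x) (toℕ (other x E))
  centralColour (inj₂ E) (inj₁ x) = tip (toℕ x) (toℕ (other x E))
  centralColour (inj₂ _) (inj₂ _) = 0F

  centralColouring : EdgeColoring (central G) 2
  centralColouring = record { col = centralColour ; csym = centralColour-sym }
    where
    centralColour-sym : ∀ x y → centralColour x y ≡ centralColour y x
    centralColour-sym (inj₁ u) (inj₁ v) = directColour-sym (toℕ u) (toℕ v)
    centralColour-sym (inj₁ _) (inj₂ _) = refl
    centralColour-sym (inj₂ _) (inj₁ _) = refl
    centralColour-sym (inj₂ _) (inj₂ _) = refl

toℕ-mod : ∀ {i n} .{{_ : NonZero n}} → i < n → toℕ (i mod n) ≡ i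
toℕ-mod {i} {n} i<n = trans (toℕ-fromℕ< _) (m<n⇒m%n≡m i<n)

module Rigidity {m : ℕ} {G : SimpleGraph (4 + m)} (connected : Connected G)
                (φ : Automorphism (central G)) (φ-preserves : Preserves φ (centralColouring G)) where
  open CentralGraph G
  open ≡-Reasoning

  M : ℕ
  M = 3 + m

  2<M : 2 < M
  2<M = s≤s (s≤s (s≤s z≤n))

  τ τ⁻¹ : CVertex G → CVertex G
  τ   = Inverse.to (perm φ)
  τ⁻¹ = Inverse.from (perm φ)

  τ-injective : Injective _≡_ _≡_ τ
  τ-injective = Injection.injective (↔⇒↣ (perm φ))

  τ⁻¹-injective : Injective _≡_ _≡_ τ⁻¹
  τ⁻¹-injective = Injection.injective (↔⇒↣ (↔-sym (perm φ)))

  τ-adjacent : ∀ {x y} → CAdj G x y → CAdj G (τ x) (τ y)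
  τ-adjacent = Equivalence.to (preserve φ _ _)

  τ⁻¹-adjacent : ∀ {x y} → CAdj G x y → CAdj G (τ⁻¹ x) (τ⁻¹ y)
  τ⁻¹-adjacent {x} {y} x~y = Equivalence.from (preserve φ (τ⁻¹ x) (τ⁻¹ y))
    (subst₂ (CAdj G) (sym (Inverse.strictlyInverseˡ (perm φ) x)) (sym (Inverse.strictlyInverseˡ (perm φ) y)) x~y)

  original-image : ∀ u → ∃[ v ] τ (inj₁ u) ≡ inj₁ v
  original-image u with τ (inj₁ u) in τu≡
  ... | inj₁ v = v , refl
  ... | inj₂ E = contradiction τu≡ (original↛subdivision G 2<M τ τ-injective τ-adjacent u E)

  subdivision-image : ∀ E → ∃[ E′ ] τ (inj₂ E) ≡ inj₂ E′
  subdivision-image E with τ (inj₂ E) in τE≡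
  ... | inj₂ E′ = E′ , refl
  ... | inj₁ v  = contradiction (trans (cong τ⁻¹ (sym τE≡)) (Inverse.strictlyInverseʳ (perm φ) (inj₂ E)))
                    (original↛subdivision G 2<M τ⁻¹ τ⁻¹-injective τ⁻¹-adjacent v E)

  σ : Fin (4 + m) → Fin (4 + m)
  σ u = proj₁ (original-image u)

  τ-original : ∀ u → τ (inj₁ u) ≡ inj₁ (σ u)
  τ-original u = proj₂ (original-image u)

  σ-injective : ∀ {u v} → σ u ≡ σ v → u ≡ v
  σ-injective {u} {v} σu≡σv =
    inj₁-injective (τ-injective (trans (τ-original u) (trans (cong inj₁ σu≡σv) (sym (τ-original v)))))

  tip-preserved : ∀ {u v} (u~v : adj G u v ≡ true) → tip (toℕ (σ u)) (toℕ (σ v)) ≡ tip (toℕ u) (toℕ v)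
  tip-preserved {u} {v} u~v with subdivision-image (edgeBetween u v u~v)
  ... | E′ , τE≡E′ = begin
    tip (toℕ (σ u)) (toℕ (σ v))
      ≡⟨ cong (tip _ ∘ toℕ) (other-endpoint E′ (adj⇒≢ u~v ∘ σ-injective) (σ-endpoint u∈E) (σ-endpoint v∈E)) ⟨
    centralColour G (inj₁ (σ u)) (inj₂ E′)      ≡⟨ cong₂ (centralColour G) (τ-original u) τE≡E′ ⟨
    centralColour G (τ (inj₁ u)) (τ (inj₂ E))   ≡⟨ φ-preserves (inj₁ u) (inj₂ E) u∈E ⟩
    centralColour G (inj₁ u) (inj₂ E)           ≡⟨ cong (tip _ ∘ toℕ) (other-endpoint E (adj⇒≢ u~v) u∈E v∈E) ⟩
    tip (toℕ u) (toℕ v)                         ∎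
    where
    E = edgeBetween u v u~v
    u∈E = edgeBetween-endpointˡ u~v
    v∈E = edgeBetween-endpointʳ u~v
    σ-endpoint : ∀ {x} → Endpoint x E → Endpoint (σ x) E′
    σ-endpoint {x} x∈E = subst₂ (CAdj G) (τ-original x) τE≡E′ (τ-adjacent x∈E)

  consecutive-preserved : ∀ {u v} → u ≢ v → Consecutive (toℕ u) (toℕ v) → Consecutive (toℕ (σ u)) (toℕ (σ v))
  consecutive-preserved {u} {v} u≢v c with adj G u v ≟ᵇ true
  ... | no u≁v = directColour≡1F⇒consecutive (begin
    directColour (toℕ (σ u)) (toℕ (σ v))         ≡⟨ cong₂ (centralColour G) (τ-original u) (τ-original v) ⟨
    centralColour G (τ (inj₁ u)) (τ (inj₁ v))    ≡⟨ φ-preserves (inj₁ u) (inj₁ v) (u≢v , ¬-not u≁v) ⟩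
    directColour (toℕ u) (toℕ v)                 ≡⟨ consecutive⇒directColour≡1F c ⟩
    1F                                           ∎)
  ... | yes u~v = tip-sym⇒consecutive (u≢v ∘ σ-injective ∘ toℕ-injective) (begin
    tip (toℕ (σ u)) (toℕ (σ v))   ≡⟨ tip-preserved u~v ⟩
    tip (toℕ u) (toℕ v)           ≡⟨ consecutive⇒tip-sym c ⟩
    tip (toℕ v) (toℕ u)           ≡⟨ tip-preserved (trans (symm G v u) u~v) ⟨
    tip (toℕ (σ v)) (toℕ (σ u))   ∎)

  -- Only applied to i ≤ M, where `mod` does nothing.
  vertex : ℕ → Fin (4 + m)
  vertex i = i mod (4 + m)

  position : ℕ → ℕ
  position i = toℕ (σ (vertex i))

  toℕ-vertex : ∀ {i} → i ≤ M → toℕ (vertex i) ≡ i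
  toℕ-vertex i≤M = toℕ-mod (s≤s i≤M)

  vertex-injective : ∀ {i j} → i ≤ M → j ≤ M → vertex i ≡ vertex j → i ≡ j
  vertex-injective i≤M j≤M eq = trans (sym (toℕ-vertex i≤M)) (trans (cong toℕ eq) (toℕ-vertex j≤M))

  position-steps : ∀ i → i < M → Consecutive (position i) (position (suc i))
  position-steps i i<M = consecutive-preserved (1+n≢n ∘ sym ∘ vertex-injective (<⇒≤ i<M) i<M)
    (inj₁ (trans (cong suc (toℕ-vertex (<⇒≤ i<M))) (sym (toℕ-vertex i<M))))

  position-no-return : ∀ i → suc i < M → position (suc (suc i)) ≢ position i
  position-no-return i 1+i<M eq =
    <-irrefl (sym (vertex-injective 1+i<M (<⇒≤ (<⇒≤ 1+i<M)) (σ-injective (toℕ-injective eq)))) (s≤s (n≤1+n i))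

  -- The tip at 0 of every subdivided edge from 0 is 0F, but none at the top vertex M is.
  not-reversed : ¬ (M ≤ position 0)
  not-reversed M≤σ0 with connected⇒neighbour G connected {1F} {0F} (λ ())
  ... | 0F    , 0~0 = adj⇒≢ 0~0 refl
  ... | suc a , a~0
    with tip≡0F⇒<∨≤1 (trans (tip-preserved (trans (symm G 0F (suc a)) a~0)) (tip-zero-suc (toℕ a)))
  ...   | inj₁ σ0<σa = <⇒≱ (<-≤-trans σ0<σa (toℕ≤pred[n] (σ (suc a)))) M≤σ0
  ...   | inj₂ σ0≤1  = <⇒≱ (s≤s (s≤s z≤n)) (≤-trans M≤σ0 σ0≤1)

  σ-fixes : ∀ u → σ u ≡ u
  σ-fixes u with consecutive-walk-monotone position M z<s position-steps position-no-return
  ... | inj₂ descending = ⊥-elim (not-reversed (subst (M ≤_) (descending M ≤-refl) (m≤n+m M (position M))))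
  ... | inj₁ ascending  = toℕ-injective (begin
    toℕ (σ u)            ≡⟨ cong (toℕ ∘ σ) (toℕ-injective (toℕ-vertex (toℕ≤pred[n] u))) ⟨
    position (toℕ u)     ≡⟨ ascending (toℕ u) (toℕ≤pred[n] u) ⟩
    position 0 + toℕ u   ≡⟨ cong (_+ toℕ u) position0≡0 ⟩
    toℕ u                ∎)
    where
    position0≡0 : position 0 ≡ 0
    position0≡0 = n≤0⇒n≡0 (+-cancelʳ-≤ M (position 0) 0
      (subst (_≤ M) (ascending M ≤-refl) (toℕ≤pred[n] (σ (vertex M)))))

  τ-fixes-original : ∀ u → τ (inj₁ u) ≡ inj₁ u
  τ-fixes-original u = trans (τ-original u) (cong inj₁ (σ-fixes u))

  τ-fixes : ∀ x → τ x ≡ x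
  τ-fixes (inj₁ u) = τ-fixes-original u
  τ-fixes (inj₂ E) with subdivision-image E
  ... | E′ , τE≡E′ = trans τE≡E′ (cong inj₂ (sym (edge-extensional E E′ λ x x∈E →
    subst₂ (CAdj G) (τ-fixes-original x) τE≡E′ (τ-adjacent x∈E))))

centralColouring-distinguishing : ∀ {m} {G : SimpleGraph (4 + m)} → Connected G →
                                  Distinguishing (centralColouring G)
centralColouring-distinguishing connected φ φ-preserves = Rigidity.τ-fixes connected φ φ-preserves

theorem3p2 : (n : ℕ) → 4 ≤ n → (G : SimpleGraph n) → Connected G →
    DistIndexLE (central G) (ceilSqrt (maxDegree G))
theorem3p2 _ (s≤s (s≤s (s≤s (s≤s _)))) G connected =
  2 , 2≤ceilSqrt (connected⇒2≤maxDegree G connected) , centralColouring G , centralColouring-distinguishing connected
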